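{- Let $h$ be a positive integer. If $G$ is a finite simple chordal graph with maximum degree $\Delta(G)$, then $$\chi^h_{\mathrm{pcf}}(G) \le 1 + (h+1) \cdot \min \left\{ s(G)-1,\ \frac{\Delta(G)+h-1}{2}\right\}.$$
   Context: A proper $k$-coloring of $G$ assigns each vertex a color in $\{1,\dots,k\}$ so that adjacent vertices get different colors. For a vertex $v$, let $h_v=\min\{\deg_G(v),h\}$. A proper $h$-conflict-free $k$-coloring of $G$ is a proper $k$-coloring such that for every vertex $v$, at least $h_v$ distinct colors each appear exactly once on $N_G(v)$; $\chi^h_{\mathrm{pcf}}(G)$ is the minimum such $k$. A chordal graph $G$ on $n$ vertices has a simplicial ordering $v_1,\dots,v_n$: for each $i\in\{1,\dots,n\}$, $v_i$ together with its neighbors in $G[\{v_i,\dots,v_n\}]$ forms a clique. For such an ordering and a vertex $v_i$, the maximal clique containing $v_i$ in the subgraph induced by $\{v_i,v_{i+1},\dots,v_n\}$ is called a simplicial clique of $G$. $s(G)$ denotes the maximum size of all possible simplicial cliques of $G$ (over all simplicial orderings and all $i$). -}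

module Defs where

open import Data.Nat using (ℕ; zero; suc; _+_; _*_; _∸_; _≤_; _<_; _⊔_; _⊓_)
open import Data.Fin using (Fin; zero; suc; toℕ)
open import Data.Fin.Properties using (_≟_)
open import Data.Bool using (Bool; true; false; _∧_; if_then_else_)
open import Data.Product using (Σ; _×_; _,_; ∃; ∃-syntax)
open import Relation.Binary.PropositionalEquality using (_≡_; _≢_)
open import Relation.Nullary using (¬_; Dec; yes; no)
open import Relation.Nullary.Decidable using (⌊_⌋)
open import Function.Bundles using (_↔_)
import Data.Nat as ℕ

record Graph (n : ℕ) : Set where
  field
    adj    : Fin n → Fin n → Bool
    sym    : ∀ u v → adj u v ≡ adj v u
    irrefl : ∀ v → adj v v ≡ false
open Graph public

Adj : ∀ {n} → Graph n → Fin n → Fin n → Set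
Adj G u v = adj G u v ≡ true

count : ∀ {n} → (Fin n → Bool) → ℕ
count {zero}  f = 0
count {suc n} f = (if f zero then 1 else 0) + count (λ i → f (suc i))

maxOver : ∀ {n} → (Fin n → ℕ) → ℕ
maxOver {zero}  f = 0
maxOver {suc n} f = f zero ⊔ maxOver (λ i → f (suc i))

deg : ∀ {n} → Graph n → Fin n → ℕ
deg G v = count (adj G v)

Δ : ∀ {n} → Graph n → ℕ
Δ G = maxOver (deg G)

Consecutive : ℕ → ℕ → ℕ → Set
Consecutive m i j = (suc i ≡ j) ⊎' (suc j ≡ i) ⊎' ((i ≡ 0) × (suc j ≡ m)) ⊎' ((j ≡ 0) × (suc i ≡ m))
  where
    open import Data.Sum using () renaming (_⊎_ to _⊎'_)

-- c 0, c 1, …, c (m-1) is a cycle of G (distinct vertices, m ≥ 3 assumed by caller)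
IsCycle : ∀ {n} → Graph n → (m : ℕ) → (ℕ → Fin n) → Set
IsCycle G m c =
  (∀ i j → i < m → j < m → c i ≡ c j → i ≡ j) ×
  (∀ i → suc i < m → Adj G (c i) (c (suc i))) ×
  Adj G (c (m ∸ 1)) (c 0)

Chordal : ∀ {n} → Graph n → Set
Chordal G = ∀ m (c : ℕ → Fin _) → 4 ≤ m → IsCycle G m c →
  ∃[ i ] ∃[ j ] (i < m × j < m × i ≢ j × ¬ Consecutive m i j × Adj G (c i) (c j))

-- Simplicial orderings and simplicial cliques.
-- An ordering v_1,…,v_n is a bijection σ : Fin n ↔ Fin n, v_{i} = σ i.

open import Data.Fin.Subset using (Subset; _∈_; _∉_; ∣_∣)

IsClique : ∀ {n} → Graph n → Subset n → Set
IsClique G K = ∀ u v → u ∈ K → v ∈ K → u ≢ v → Adj G u v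

IsSimplicialOrdering : ∀ {n} → Graph n → (Fin n ↔ Fin n) → Set
IsSimplicialOrdering G σ = ∀ i j k → i Data.Fin.< j → i Data.Fin.< k → j ≢ k →
  Adj G (f i) (f j) → Adj G (f i) (f k) → Adj G (f j) (f k)
  where
    open Function.Bundles.Inverse σ renaming (to to f)
    import Data.Fin

-- K is a maximal clique containing v_i in G[{v_i, …, v_n}]
IsSimplicialClique : ∀ {n} → Graph n → (Fin n ↔ Fin n) → Fin n → Subset n → Set
IsSimplicialClique G σ i K =
  (∀ v → v ∈ K → ∃[ j ] (i Data.Fin.≤ j × f j ≡ v)) ×
  f i ∈ K ×
  IsClique G K ×
  (∀ j → i Data.Fin.≤ j → f j ∉ K → ∃[ u ] (u ∈ K × ¬ Adj G u (f j)))
  where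
    open Function.Bundles.Inverse σ renaming (to to f)
    import Data.Fin

IsMaxSimplicialCliqueSize : ∀ {n} → Graph n → ℕ → Set
IsMaxSimplicialCliqueSize {n} G s =
  (∃[ σ ] ∃[ i ] ∃[ K ] (IsSimplicialOrdering G σ × IsSimplicialClique G σ i K × ∣ K ∣ ≡ s)) ×
  (∀ σ i K → IsSimplicialOrdering G σ → IsSimplicialClique G σ i K → ∣ K ∣ ≤ s)

IsProperColoring : ∀ {n k} → Graph n → (Fin n → Fin k) → Set
IsProperColoring G col = ∀ u v → Adj G u v → col u ≢ col v

occ : ∀ {n k} → Graph n → (Fin n → Fin k) → Fin n → Fin k → ℕ
occ G col v c = count (λ u → adj G v u ∧ ⌊ col u ≟ c ⌋)

uniqueColours : ∀ {n k} → Graph n → (Fin n → Fin k) → Fin n → ℕ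
uniqueColours {k = k} G col v = count {k} (λ c → ⌊ occ G col v c ℕ.≟ 1 ⌋)

IsProperCFColoring : ∀ {n k} → ℕ → Graph n → (Fin n → Fin k) → Set
IsProperCFColoring h G col =
  IsProperColoring G col × (∀ v → deg G v ⊓ h ≤ uniqueColours G col v)

-- Colour the vertices greedily in reverse simplicial order, maintaining for the coloured suffix S
-- that the colouring is proper on S and that every vertex x, coloured or not, has at least
-- min(h, |N(x) ∩ S|) neighbours in S whose colour is unique on N(x) ∩ S.  The next vertex w has its
-- neighbours L in S forming a clique, so |L| ≤ s − 1 and |L| ≤ Δ, and simpliciality gives
-- N(x) ∩ S ⊆ L for every earlier neighbour x of w.  Hence w only has to avoid the colours of L and,
-- for each x ∈ L, of the neighbours that x cannot afford to lose: all of N(x) ∩ S if x has fewer than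
-- h unique neighbours there, the unique ones if it has exactly h.  That is at most |L|(h + 1) colours.
-- If Δ + h ≤ 2|L|, all those neighbours already lie in L: a non-unique colour inside the properly
-- coloured clique L has a twin outside it, and then the degree of x leaves no room for a unique
-- neighbour outside L.  So |L| colours are forbidden, and in both cases fewer than the bound.

module Submission where

open import Defs hiding (sym)
open import Data.Nat using (ℕ; zero; suc; _+_; _*_; _∸_; _≤_; _<_; _⊓_; z≤n; s≤s; _≤ᵇ_)
import Data.Nat as ℕ
open import Data.Nat.Properties hiding (_≟_; suc-injective)
open import Algebra.Properties.CommutativeSemigroup +-commutativeSemigroup using (x∙yz≈y∙xz)
open import Data.Fin using (Fin; zero; suc; toℕ; fromℕ<)
import Data.Fin
open import Data.Fin.Properties using (_≟_; any?; suc-injective; toℕ-fromℕ<; toℕ-injective; toℕ<n)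
open import Data.Bool using (Bool; true; false; _∧_; _∨_; not; if_then_else_)
open import Data.Bool.Properties using (∧-comm; ∧-zeroʳ; ∧-identityʳ; ¬-not; T-≡)
import Data.Bool.Properties as Bool
open import Data.Product using (Σ; _×_; _,_; proj₁; proj₂; ∃; ∃-syntax)
open import Data.Sum using (_⊎_; inj₁; inj₂)
open import Data.Empty using (⊥-elim)
open import Relation.Binary.PropositionalEquality
open import Relation.Binary.Definitions using (tri<; tri≈; tri>)
open import Relation.Nullary using (¬_; Dec; yes; no)
open import Relation.Nullary.Decidable using (⌊_⌋)
open import Function using (_∘_; case_of_)
open import Function.Bundles using (_↔_; Inverse; Equivalence)
open import Data.Fin.Subset using (Subset; _∈_; _∉_; ∣_∣)
open import Data.Vec using (tabulate)
open import Data.Vec.Properties using (lookup∘tabulate; []=⇒lookup; lookup⇒[]=)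
open import Data.Nat.Tactic.RingSolver using (solve-∀)

∧-elimˡ : ∀ {a b} → a ∧ b ≡ true → a ≡ true
∧-elimˡ {true} _ = refl

∧-elimʳ : ∀ {a b} → a ∧ b ≡ true → b ≡ true
∧-elimʳ {true} e = e

∧-intro : ∀ {a b} → a ≡ true → b ≡ true → a ∧ b ≡ true
∧-intro refl refl = refl

∨-introˡ : ∀ {a b} → a ≡ true → a ∨ b ≡ true
∨-introˡ refl = refl

∨-introʳ : ∀ {a b} → b ≡ true → a ∨ b ≡ true
∨-introʳ {true}  _ = refl
∨-introʳ {false} e = e

not≡true⇒≡false : ∀ {a} → not a ≡ true → a ≡ false
not≡true⇒≡false {false} _ = refl

≡false⇒not≡true : ∀ {a} → a ≡ false → not a ≡ true
≡false⇒not≡true refl = refl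

≡true⇒≢false : ∀ {a} → a ≡ true → a ≢ false
≡true⇒≢false refl ()

≢true⇒≡false : ∀ {a} → a ≢ true → a ≡ false
≢true⇒≡false = ¬-not

⌊⌋-sound : ∀ {P : Set} (P? : Dec P) → ⌊ P? ⌋ ≡ true → P
⌊⌋-sound (yes p) _ = p

⌊⌋-true : ∀ {P : Set} (P? : Dec P) → P → ⌊ P? ⌋ ≡ true
⌊⌋-true (yes _) _ = refl
⌊⌋-true (no ¬p) p = ⊥-elim (¬p p)

⌊⌋-false : ∀ {P : Set} (P? : Dec P) → ¬ P → ⌊ P? ⌋ ≡ false
⌊⌋-false (yes p) ¬p = ⊥-elim (¬p p)
⌊⌋-false (no _)  _  = refl

_≢ᵇ_ : ∀ {n} → Fin n → Fin n → Bool
i ≢ᵇ a = not ⌊ i ≟ a ⌋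

≢ᵇ-irrefl : ∀ {n} (a : Fin n) → a ≢ᵇ a ≡ false
≢ᵇ-irrefl a = cong not (⌊⌋-true (a ≟ a) refl)

≢⇒≢ᵇ : ∀ {n} {i a : Fin n} → i ≢ a → i ≢ᵇ a ≡ true
≢⇒≢ᵇ {i = i} {a} i≢a = cong not (⌊⌋-false (i ≟ a) i≢a)

≢ᵇ-suc : ∀ {n} (i a : Fin n) → suc i ≢ᵇ suc a ≡ i ≢ᵇ a
≢ᵇ-suc i a with i ≟ a
... | yes _ = refl
... | no  _ = refl

any : ∀ {n} → (Fin n → Bool) → Bool
any {zero}  p = false
any {suc n} p = p zero ∨ any (p ∘ suc)

any-intro : ∀ {n} (p : Fin n → Bool) i → p i ≡ true → any p ≡ true
any-intro p zero    e = ∨-introˡ e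
any-intro p (suc i) e = ∨-introʳ {p zero} (any-intro (p ∘ suc) i e)

any-elim : ∀ {n} (p : Fin n → Bool) → any p ≡ true → ∃ λ i → p i ≡ true
any-elim {suc n} p e with p zero in e₀
... | true  = zero , e₀
... | false = let i , q = any-elim (p ∘ suc) e in suc i , q

search : ∀ {n} (p : Fin n → Bool) → Dec (∃ λ i → p i ≡ true)
search p = any? (λ i → p i Bool.≟ true)

choose : ∀ {n} (p : Fin n → Bool) → Fin n → Fin n
choose p default with search p
... | yes (i , _) = i
... | no _        = default

choose-spec : ∀ {n} (p : Fin n → Bool) default i → p i ≡ true → p (choose p default) ≡ true
choose-spec p default i pᵢ with search p
... | yes (_ , q) = q
... | no  none    = ⊥-elim (none (i , pᵢ))

indicator : Bool → ℕ
indicator b = if b then 1 else 0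

count-cong : ∀ {n} {p q : Fin n → Bool} → (∀ i → p i ≡ q i) → count p ≡ count q
count-cong {zero}          e = refl
count-cong {suc n} {p} {q} e rewrite e zero = cong (indicator (q zero) +_) (count-cong (e ∘ suc))

count-mono : ∀ {n} (p q : Fin n → Bool) → (∀ i → p i ≡ true → q i ≡ true) → count p ≤ count q
count-mono {zero}  p q p⊆q = z≤n
count-mono {suc n} p q p⊆q with p zero in p₀ | q zero in q₀
... | true  | true  = s≤s (count-mono (p ∘ suc) (q ∘ suc) (p⊆q ∘ suc))
... | true  | false = ⊥-elim (≡true⇒≢false (p⊆q zero p₀) q₀)
... | false | true  = m≤n⇒m≤1+n (count-mono (p ∘ suc) (q ∘ suc) (p⊆q ∘ suc))
... | false | false = count-mono (p ∘ suc) (q ∘ suc) (p⊆q ∘ suc)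

count-all : ∀ {n} (p : Fin n → Bool) → (∀ i → p i ≡ true) → count p ≡ n
count-all {zero}  p all = refl
count-all {suc n} p all rewrite all zero = cong suc (count-all (p ∘ suc) (all ∘ suc))

count-none : ∀ {n} (p : Fin n → Bool) → (∀ i → p i ≡ false) → count p ≡ 0
count-none {zero}  p none = refl
count-none {suc n} p none rewrite none zero = count-none (p ∘ suc) (none ∘ suc)

count-split : ∀ {n} (p q : Fin n → Bool) →
  count p ≡ count (λ i → p i ∧ q i) + count (λ i → p i ∧ not (q i))
count-split {zero}  p q = refl
count-split {suc n} p q with p zero | q zero
... | true  | true  = cong suc (count-split (p ∘ suc) (q ∘ suc))
... | true  | false = trans (cong suc (count-split (p ∘ suc) (q ∘ suc))) (sym (+-suc _ _))
... | false | _     = count-split (p ∘ suc) (q ∘ suc)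

count-∨ : ∀ {n} (p q : Fin n → Bool) → count (λ i → p i ∨ q i) ≤ count p + count q
count-∨ {zero}  p q = z≤n
count-∨ {suc n} p q with p zero | q zero
... | true  | true  = s≤s (≤-trans (count-∨ (p ∘ suc) (q ∘ suc)) (+-monoʳ-≤ (count (p ∘ suc)) (n≤1+n _)))
... | true  | false = s≤s (count-∨ (p ∘ suc) (q ∘ suc))
... | false | true  = ≤-trans (s≤s (count-∨ (p ∘ suc) (q ∘ suc))) (≤-reflexive (sym (+-suc _ _)))
... | false | false = count-∨ (p ∘ suc) (q ∘ suc)

count-at : ∀ {n} (p : Fin n → Bool) a → count p ≡ indicator (p a) + count (λ i → p i ∧ i ≢ᵇ a)
count-at {suc n} p zero rewrite ∧-zeroʳ (p zero) =
  cong (indicator (p zero) +_) (count-cong (λ i → sym (∧-identityʳ (p (suc i)))))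
count-at {suc n} p (suc a) rewrite ∧-identityʳ (p zero) = begin
  indicator (p zero) + count (p ∘ suc)
    ≡⟨ cong (indicator (p zero) +_) (count-at (p ∘ suc) a) ⟩
  indicator (p zero) + (indicator (p (suc a)) + count (λ i → p (suc i) ∧ i ≢ᵇ a))
    ≡⟨ x∙yz≈y∙xz (indicator (p zero)) (indicator (p (suc a))) _ ⟩
  indicator (p (suc a)) + (indicator (p zero) + count (λ i → p (suc i) ∧ i ≢ᵇ a))
    ≡⟨ cong (λ c → indicator (p (suc a)) + (indicator (p zero) + c))
            (count-cong (λ i → cong (p (suc i) ∧_) (sym (≢ᵇ-suc i a)))) ⟩
  indicator (p (suc a)) + (indicator (p zero) + count (λ i → p (suc i) ∧ suc i ≢ᵇ suc a)) ∎
  where open ≡-Reasoning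

count-remove : ∀ {n} (p : Fin n → Bool) a → p a ≡ true → count p ≡ suc (count (λ i → p i ∧ i ≢ᵇ a))
count-remove p a pₐ = trans (count-at p a) (cong (λ b → indicator b + count (λ i → p i ∧ i ≢ᵇ a)) pₐ)

count-pos : ∀ {n} (p : Fin n → Bool) a → p a ≡ true → 1 ≤ count p
count-pos p a pₐ rewrite count-remove p a pₐ = s≤s z≤n

count≡1⇒unique : ∀ {n} (p : Fin n → Bool) → count p ≡ 1 → ∀ i j → p i ≡ true → p j ≡ true → i ≡ j
count≡1⇒unique p one i j pᵢ pⱼ with i ≟ j
... | yes i≡j = i≡j
... | no  i≢j = ⊥-elim (<-irrefl refl (≤-trans (s≤s (count-pos _ j (∧-intro pⱼ (≢⇒≢ᵇ (i≢j ∘ sym)))))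
                                               (≤-reflexive (trans (sym (count-remove p i pᵢ)) one))))

count-injection : ∀ {n m} (p : Fin n → Bool) (q : Fin m → Bool) (f : Fin n → Fin m) →
  (∀ i → p i ≡ true → q (f i) ≡ true) →
  (∀ i j → p i ≡ true → p j ≡ true → f i ≡ f j → i ≡ j) → count p ≤ count q
count-injection {zero}  p q f maps inj = z≤n
count-injection {suc n} p q f maps inj with p zero in p₀
... | false = count-injection (p ∘ suc) q (f ∘ suc) (maps ∘ suc) (λ i j pᵢ pⱼ e → suc-injective (inj (suc i) (suc j) pᵢ pⱼ e))
... | true rewrite count-remove q (f zero) (maps zero p₀) =
  s≤s (count-injection (p ∘ suc) _ (f ∘ suc) mapsˢ (λ i j pᵢ pⱼ e → suc-injective (inj (suc i) (suc j) pᵢ pⱼ e)))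
  where
    mapsˢ : ∀ i → p (suc i) ≡ true → q (f (suc i)) ∧ f (suc i) ≢ᵇ f zero ≡ true
    mapsˢ i pᵢ = ∧-intro (maps (suc i) pᵢ) (≢⇒≢ᵇ (λ e → case inj (suc i) zero pᵢ p₀ e of λ ()))

count-⋃ : ∀ {n m} (p : Fin n → Bool) (q : Fin n → Fin m → Bool) (b : ℕ) →
  (∀ x → p x ≡ true → count (q x) ≤ b) →
  count (λ y → any (λ x → p x ∧ q x y)) ≤ count p * b
count-⋃ {zero}  {m} p q b bound = ≤-reflexive (count-none {m} _ (λ _ → refl))
count-⋃ {suc n}     p q b bound with p zero in p₀
... | true  = ≤-trans (count-∨ (q zero) (λ y → any (λ x → p (suc x) ∧ q (suc x) y)))
                      (+-mono-≤ (bound zero p₀) (count-⋃ (p ∘ suc) (q ∘ suc) b (bound ∘ suc)))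
... | false = count-⋃ (p ∘ suc) (q ∘ suc) b (bound ∘ suc)

count-image : ∀ {n m} (p : Fin n → Bool) (f : Fin n → Fin m) →
  count (λ c → any (λ y → p y ∧ ⌊ f y ≟ c ⌋)) ≤ count p
count-image {zero}  {m} p f = ≤-reflexive (count-none {m} _ (λ _ → refl))
count-image {suc n} {m} p f = count-injection image p preimage (λ c e → ∧-elimˡ (preimage-spec c e)) injective
  where
    hit : Fin m → Fin (suc n) → Bool
    hit c y = p y ∧ ⌊ f y ≟ c ⌋
    image : Fin m → Bool
    image c = any (hit c)
    preimage : Fin m → Fin (suc n)
    preimage c = choose (hit c) zero
    preimage-spec : ∀ c → image c ≡ true → hit c (preimage c) ≡ true
    preimage-spec c e = let y , q = any-elim (hit c) e in choose-spec (hit c) zero y q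
    f-preimage : ∀ c → image c ≡ true → f (preimage c) ≡ c
    f-preimage c e = ⌊⌋-sound (f (preimage c) ≟ c) (∧-elimʳ {p (preimage c)} (preimage-spec c e))
    injective : ∀ c d → image c ≡ true → image d ≡ true → preimage c ≡ preimage d → c ≡ d
    injective c d ec ed eq = trans (sym (f-preimage c ec)) (trans (cong f eq) (f-preimage d ed))

count≡∣tabulate∣ : ∀ {n} (p : Fin n → Bool) → count p ≡ ∣ tabulate p ∣
count≡∣tabulate∣ {zero}  p = refl
count≡∣tabulate∣ {suc n} p with p zero
... | true  = cong suc (count≡∣tabulate∣ (p ∘ suc))
... | false = count≡∣tabulate∣ (p ∘ suc)

maxOver-upper : ∀ {n} (F : Fin n → ℕ) i → F i ≤ maxOver F
maxOver-upper F zero    = m≤m⊔n _ _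
maxOver-upper F (suc i) = m≤n⇒m≤o⊔n (F zero) (maxOver-upper (F ∘ suc) i)

⊓-suc-≤ : ∀ h a → h ⊓ suc a ≤ suc (h ⊓ a)
⊓-suc-≤ zero    a = z≤n
⊓-suc-≤ (suc h) a = s≤s (⊓-monoˡ-≤ a (n≤1+n h))

excess≡0 : ∀ Δ h m u d e → suc (m + (d + e)) ≤ Δ → m ≡ u + e → h ≡ u + d → Δ + h ≤ 2 * suc m → d ≡ 0
excess≡0 Δ h m u zero    e _ _ _ _ = refl
excess≡0 Δ h m u (suc d) e m+d+e<Δ refl refl Δ+h≤ = ⊥-elim (m+1+n≰m (2 * suc (u + e)) (begin
  2 * suc (u + e) + suc (d + d)               ≡⟨ rearrange u e d ⟩
  suc ((u + e) + (suc d + e)) + (u + suc d)   ≤⟨ +-monoˡ-≤ (u + suc d) m+d+e<Δ ⟩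
  Δ + (u + suc d)                             ≤⟨ Δ+h≤ ⟩
  2 * suc (u + e)                             ∎))
  where
    open ≤-Reasoning
    rearrange : ∀ u e d → 2 * suc (u + e) + suc (d + d) ≡ suc ((u + e) + (suc d + e)) + (u + suc d)
    rearrange = solve-∀

module ReverseGreedy {n : ℕ} (G : Graph n) (σ : Fin n ↔ Fin n)
                     (simplicial : IsSimplicialOrdering G σ) (h k : ℕ) where

  open Inverse σ using () renaming (to to vertex; from to position;
    strictlyInverseˡ to vertex-position; strictlyInverseʳ to position-vertex)

  rank : Fin n → ℕ
  rank v = toℕ (position v)

  rank-injective : ∀ u v → rank u ≡ rank v → u ≡ v
  rank-injective u v e = trans (sym (vertex-position u)) (trans (cong vertex (toℕ-injective e)) (vertex-position v))

  vertexOfRank : (p : ℕ) → p < n → Fin n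
  vertexOfRank p p<n = vertex (fromℕ< p<n)

  rank-vertexOfRank : ∀ p p<n → rank (vertexOfRank p p<n) ≡ p
  rank-vertexOfRank p p<n = trans (cong toℕ (position-vertex _)) (toℕ-fromℕ< p<n)

  deg≤Δ : ∀ x → deg G x ≤ Δ G
  deg≤Δ = maxOver-upper (deg G)

  Adj-sym : ∀ u v → Adj G u v → Adj G v u
  Adj-sym u v e = trans (Graph.sym G v u) e

  Adj⇒≢ : ∀ u v → Adj G u v → u ≢ v
  Adj⇒≢ u .u e refl = ≡true⇒≢false e (irrefl G u)

  later-nbrs-adjacent : ∀ v a b → rank v < rank a → rank v < rank b → a ≢ b →
                        Adj G v a → Adj G v b → Adj G a b
  later-nbrs-adjacent v a b v<a v<b a≢b va vb =
    subst₂ (Adj G) (vertex-position a) (vertex-position b)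
      (simplicial (position v) (position a) (position b) v<a v<b
        (λ e → a≢b (trans (sym (vertex-position a)) (trans (cong vertex e) (vertex-position b))))
        (subst₂ (Adj G) (sym (vertex-position v)) (sym (vertex-position a)) va)
        (subst₂ (Adj G) (sym (vertex-position v)) (sym (vertex-position b)) vb))

  inSuffix : ℕ → Fin n → Bool
  inSuffix p v = p ≤ᵇ rank v

  inSuffix-intro : ∀ {p v} → p ≤ rank v → inSuffix p v ≡ true
  inSuffix-intro p≤ = Equivalence.to T-≡ (≤⇒≤ᵇ p≤)

  inSuffix-elim : ∀ {p v} → inSuffix p v ≡ true → p ≤ rank v
  inSuffix-elim {p} {v} e = ≤ᵇ⇒≤ p (rank v) (Equivalence.from T-≡ e)

  inSuffix-false : ∀ {p v} → inSuffix p v ≡ false → rank v < p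
  inSuffix-false e = ≰⇒> (λ p≤ → ≡true⇒≢false (inSuffix-intro p≤) e)

  nbrIn : ℕ → Fin n → Fin n → Bool
  nbrIn p x y = adj G x y ∧ inSuffix p y

  occIn : ℕ → (Fin n → Fin k) → Fin n → Fin k → ℕ
  occIn p col x c = count (λ z → nbrIn p x z ∧ ⌊ col z ≟ c ⌋)

  uniqueNbrIn : ℕ → (Fin n → Fin k) → Fin n → Fin n → Bool
  uniqueNbrIn p col x y = nbrIn p x y ∧ ⌊ occIn p col x (col y) ℕ.≟ 1 ⌋

  ProperOn : ℕ → (Fin n → Fin k) → Set
  ProperOn p col = ∀ u v → Adj G u v → inSuffix p u ≡ true → inSuffix p v ≡ true → col u ≢ col v

  -- Required of every vertex x, coloured or not: this is what makes the induction go through.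
  ConflictFreeOn : ℕ → (Fin n → Fin k) → Set
  ConflictFreeOn p col = ∀ x → h ⊓ count (nbrIn p x) ≤ count (uniqueNbrIn p col x)

  Good : ℕ → (Fin n → Fin k) → Set
  Good p col = ProperOn p col × ConflictFreeOn p col

  -- A vertex with u unique neighbours in the suffix must keep all its neighbours' colours unique
  -- when u < h, only its unique ones when u = h, and can afford to lose one when u > h.
  mustKeep : ℕ → Bool → Bool → Bool
  mustKeep u nbr unique = if ⌊ u <? h ⌋ then nbr else (if ⌊ u ℕ.≟ h ⌋ then unique else false)

  mustKeep-< : ∀ {u} a b → u < h → mustKeep u a b ≡ a
  mustKeep-< {u} a b u<h rewrite ⌊⌋-true (u <? h) u<h = refl

  mustKeep-≡ : ∀ {u} a b → u ≡ h → mustKeep u a b ≡ b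
  mustKeep-≡ {u} a b u≡h rewrite ⌊⌋-false (u <? h) (<-irrefl u≡h) | ⌊⌋-true (u ℕ.≟ h) u≡h = refl

  mustKeep-> : ∀ {u} a b → h < u → mustKeep u a b ≡ false
  mustKeep-> {u} a b h<u
    rewrite ⌊⌋-false (u <? h) (<-asym h<u) | ⌊⌋-false (u ℕ.≟ h) (λ u≡h → <-irrefl (sym u≡h) h<u) = refl

  laterNbrs : (p : ℕ) → p < n → Fin n → Bool
  laterNbrs p p<n = nbrIn (suc p) (vertexOfRank p p<n)

  module ClosedLaterNbhd (p : ℕ) (p<n : p < n) where
    w : Fin n
    w = vertexOfRank p p<n

    L : Fin n → Bool
    L = laterNbrs p p<n

    member : Fin n → Bool
    member v = ⌊ v ≟ w ⌋ ∨ L v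

    K : Subset n
    K = tabulate member

    ∈K-intro : ∀ v → member v ≡ true → v ∈ K
    ∈K-intro v e = lookup⇒[]= v K (trans (lookup∘tabulate member v) e)

    member-elim : ∀ v → member v ≡ true → v ≡ w ⊎ L v ≡ true
    member-elim v e with v ≟ w
    ... | yes v≡w = inj₁ v≡w
    ... | no  _   = inj₂ e

    ∈K-elim : ∀ v → v ∈ K → v ≡ w ⊎ L v ≡ true
    ∈K-elim v v∈K = member-elim v (trans (sym (lookup∘tabulate member v)) ([]=⇒lookup v∈K))

    w∈K : w ∈ K
    w∈K = ∈K-intro w (∨-introˡ (⌊⌋-true (w ≟ w) refl))

    L-rank : ∀ y → L y ≡ true → rank w < rank y
    L-rank y e = subst (_< rank y) (sym (rank-vertexOfRank p p<n)) (inSuffix-elim (∧-elimʳ {adj G w y} e))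

    ∣K∣≡1+∣L∣ : ∣ K ∣ ≡ suc (count L)
    ∣K∣≡1+∣L∣ = begin
      ∣ K ∣                                               ≡⟨ count≡∣tabulate∣ member ⟨
      count member                                        ≡⟨ count-at member w ⟩
      indicator (member w) + count (λ v → member v ∧ v ≢ᵇ w)
        ≡⟨ cong₂ _+_ (cong (λ b → indicator (b ∨ L w)) (⌊⌋-true (w ≟ w) refl)) (count-cong member∖w≡L) ⟩
      suc (count L)                                       ∎
      where
        open ≡-Reasoning
        member∖w≡L : ∀ v → member v ∧ v ≢ᵇ w ≡ L v
        member∖w≡L v with v ≟ w
        ... | yes refl = sym (cong (_∧ inSuffix (suc p) w) (irrefl G w))
        ... | no  _    = ∧-identityʳ (L v)

    simplicialClique : IsSimplicialClique G σ (position w) K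
    simplicialClique = inSuffix-K , subst (_∈ K) (sym (vertex-position w)) w∈K , clique , maximal
      where
        inSuffix-K : ∀ v → v ∈ K → ∃[ j ] (position w Data.Fin.≤ j × vertex j ≡ v)
        inSuffix-K v v∈K with ∈K-elim v v∈K
        ... | inj₁ refl = position w , ≤-refl , vertex-position w
        ... | inj₂ e    = position v , <⇒≤ (L-rank v e) , vertex-position v
        clique : IsClique G K
        clique u v u∈K v∈K u≢v with ∈K-elim u u∈K | ∈K-elim v v∈K
        ... | inj₁ refl | inj₁ refl = ⊥-elim (u≢v refl)
        ... | inj₁ refl | inj₂ ev   = ∧-elimˡ {adj G w v} ev
        ... | inj₂ eu   | inj₁ refl = Adj-sym w u (∧-elimˡ {adj G w u} eu)
        ... | inj₂ eu   | inj₂ ev   =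
          later-nbrs-adjacent w u v (L-rank u eu) (L-rank v ev) u≢v (∧-elimˡ {adj G w u} eu) (∧-elimˡ {adj G w v} ev)
        maximal : ∀ j → position w Data.Fin.≤ j → vertex j ∉ K → ∃[ u ] (u ∈ K × ¬ Adj G u (vertex j))
        maximal j w≤j j∉K =
          w , w∈K , λ a → j∉K (∈K-intro (vertex j) (∨-introʳ {⌊ vertex j ≟ w ⌋} (∧-intro {adj G w (vertex j)} a j∈S)))
          where
            j≢w : vertex j ≢ w
            j≢w e = j∉K (subst (_∈ K) (sym e) w∈K)
            j∈S : inSuffix (suc p) (vertex j) ≡ true
            j∈S = inSuffix-intro (≤∧≢⇒<
              (subst₂ _≤_ (rank-vertexOfRank p p<n) (sym (cong toℕ (position-vertex j))) w≤j)
              (λ e → j≢w (rank-injective (vertex j) w (trans (sym e) (sym (rank-vertexOfRank p p<n))))))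

  laterNbrs-bound : ∀ {s} → (∀ i K → IsSimplicialClique G σ i K → ∣ K ∣ ≤ s) →
                    ∀ p p<n → suc (count (laterNbrs p p<n)) ≤ s
  laterNbrs-bound {s} cliques≤s p p<n = subst (_≤ s) ∣K∣≡1+∣L∣ (cliques≤s (position w) K simplicialClique)
    where open ClosedLaterNbhd p p<n

  module Extension (p : ℕ) (p<n : p < n) (col : Fin n → Fin k) (good : Good (suc p) col) where
    proper₁ : ProperOn (suc p) col
    proper₁ = proj₁ good

    cf₁ : ConflictFreeOn (suc p) col
    cf₁ = proj₂ good

    w : Fin n
    w = vertexOfRank p p<n

    rank-w : rank w ≡ p
    rank-w = rank-vertexOfRank p p<n

    w∉S₁ : inSuffix (suc p) w ≡ false
    w∉S₁ = ≢true⇒≡false (λ e → <-irrefl (sym rank-w) (inSuffix-elim e))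

    w∈S₀ : inSuffix p w ≡ true
    w∈S₀ = inSuffix-intro (≤-reflexive (sym rank-w))

    S₁⊆S₀ : ∀ y → inSuffix (suc p) y ≡ true → inSuffix p y ≡ true
    S₁⊆S₀ y e = inSuffix-intro (≤-trans (n≤1+n p) (inSuffix-elim e))

    S₀⊆S₁ : ∀ y → y ≢ w → inSuffix p y ≡ true → inSuffix (suc p) y ≡ true
    S₀⊆S₁ y y≢w e =
      inSuffix-intro (≤∧≢⇒< (inSuffix-elim e) (λ p≡ → y≢w (rank-injective y w (trans (sym p≡) (sym rank-w)))))

    S₀≡S₁ : ∀ y → y ≢ w → inSuffix p y ≡ inSuffix (suc p) y
    S₀≡S₁ y y≢w with inSuffix (suc p) y in e
    ... | true  = S₁⊆S₀ y e
    ... | false = ≢true⇒≡false (λ e₀ → ≡true⇒≢false (S₀⊆S₁ y y≢w e₀) e)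

    N₁ : Fin n → Fin n → Bool
    N₁ = nbrIn (suc p)

    U₁ : Fin n → Fin n → Bool
    U₁ = uniqueNbrIn (suc p) col

    occ₁ : Fin n → Fin k → ℕ
    occ₁ = occIn (suc p) col

    N₁-w : ∀ x → N₁ x w ≡ false
    N₁-w x = trans (cong (adj G x w ∧_) w∉S₁) (∧-zeroʳ (adj G x w))

    L : Fin n → Bool
    L = laterNbrs p p<n

    t : ℕ
    t = count L

    L-S₁ : ∀ y → L y ≡ true → inSuffix (suc p) y ≡ true
    L-S₁ y = ∧-elimʳ {adj G w y}

    L-rank : ∀ y → L y ≡ true → rank w < rank y
    L-rank y e = subst (_< rank y) (sym rank-w) (inSuffix-elim (L-S₁ y e))

    L-clique : ∀ x y → L x ≡ true → L y ≡ true → x ≢ y → Adj G x y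
    L-clique x y lx ly x≢y = later-nbrs-adjacent w x y (L-rank x lx) (L-rank y ly) x≢y (∧-elimˡ lx) (∧-elimˡ ly)

    L-colours-distinct : ∀ x y → L x ≡ true → L y ≡ true → x ≢ y → col x ≢ col y
    L-colours-distinct x y lx ly x≢y = proper₁ x y (L-clique x y lx ly x≢y) (L-S₁ x lx) (L-S₁ y ly)

    t≤Δ : t ≤ Δ G
    t≤Δ = ≤-trans (count-mono L (adj G w) (λ y → ∧-elimˡ)) (deg≤Δ w)

    uniqueCount : Fin n → ℕ
    uniqueCount x = count (U₁ x)

    kept : Fin n → Fin n → Bool
    kept x y = mustKeep (uniqueCount x) (N₁ x y) (U₁ x y)

    Blocked : Fin n → Bool
    Blocked y = L y ∨ any (λ x → L x ∧ kept x y)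

    Forbidden : Fin k → Bool
    Forbidden c = any (λ y → Blocked y ∧ ⌊ col y ≟ c ⌋)

    Forbidden≤Blocked : count Forbidden ≤ count Blocked
    Forbidden≤Blocked = count-image Blocked col

    Blocked≤ : (b : ℕ) → (∀ x → L x ≡ true → count (λ y → kept x y ∧ not (L y)) ≤ b) → count Blocked ≤ t + t * b
    Blocked≤ b kept≤b = ≤-trans (≤-reflexive (count-split Blocked L))
       (+-mono-≤ (count-mono _ _ (λ y e → ∧-elimʳ {Blocked y} e))
                 (≤-trans (count-mono _ _ outside-L) (count-⋃ L (λ x y → kept x y ∧ not (L y)) b kept≤b)))
      where
        outside-L : ∀ y → Blocked y ∧ not (L y) ≡ true → any (λ x → L x ∧ (kept x y ∧ not (L y))) ≡ true
        outside-L y e with L y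
        ... | false = let x , q = any-elim _ (∧-elimˡ e) in
          any-intro (λ x → L x ∧ (kept x y ∧ true)) x
                    (∧-intro {L x} (∧-elimˡ {L x} q) (∧-intro {kept x y} (∧-elimʳ {L x} q) refl))

    few-unique⇒few-nbrs : ∀ x → uniqueCount x < h → count (N₁ x) ≤ uniqueCount x
    few-unique⇒few-nbrs x u<h with ≤-total h (count (N₁ x))
    ... | inj₁ h≤ = ⊥-elim (<-irrefl refl (<-≤-trans u<h (subst (_≤ uniqueCount x) (m≤n⇒m⊓n≡m h≤) (cf₁ x))))
    ... | inj₂ ≤h = subst (_≤ uniqueCount x) (m≥n⇒m⊓n≡n ≤h) (cf₁ x)

    kept≤h : ∀ x → count (kept x) ≤ h
    kept≤h x with <-cmp (uniqueCount x) h
    ... | tri< u<h _ _ = ≤-trans (≤-reflexive (count-cong (λ y → mustKeep-< (N₁ x y) (U₁ x y) u<h)))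
                                 (≤-trans (few-unique⇒few-nbrs x u<h) (<⇒≤ u<h))
    ... | tri≈ _ u≡h _ = ≤-trans (≤-reflexive (count-cong (λ y → mustKeep-≡ (N₁ x y) (U₁ x y) u≡h))) (≤-reflexive u≡h)
    ... | tri> _ _ h<u = ≤-trans (≤-reflexive (trans (count-cong (λ y → mustKeep-> (N₁ x y) (U₁ x y) h<u))
                                                      (count-none {n} (λ _ → false) (λ _ → refl)))) z≤n

    kept-outside-L≤h : ∀ x → L x ≡ true → count (λ y → kept x y ∧ not (L y)) ≤ h
    kept-outside-L≤h x _ = ≤-trans (count-mono _ _ (λ y e → ∧-elimˡ {kept x y} e)) (kept≤h x)

    dense⇒h≤t : Δ G + h ≤ 2 * t → h ≤ t
    dense⇒h≤t dense = subst (h ≤_) (+-identityʳ t) (+-cancelˡ-≤ t h (t + 0) (≤-trans (+-monoˡ-≤ h t≤Δ) dense))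

    module Mates (x : Fin n) (x∈L : L x ≡ true) where
      mate : Fin n → Bool
      mate y = L y ∧ y ≢ᵇ x

      mate-L : ∀ y → mate y ≡ true → L y ≡ true
      mate-L y = ∧-elimˡ {L y}

      mate-≢ : ∀ y → mate y ≡ true → x ≢ y
      mate-≢ y e refl = ≡true⇒≢false (∧-elimʳ {L x} e) (≢ᵇ-irrefl x)

      mate⇒N₁ : ∀ y → mate y ≡ true → N₁ x y ≡ true
      mate⇒N₁ y e = ∧-intro {adj G x y} (L-clique x y x∈L (mate-L y e) (mate-≢ y e)) (L-S₁ y (mate-L y e))

      t≡1+mates : t ≡ suc (count mate)
      t≡1+mates = count-remove L x x∈L

      N₁<deg : suc (count (N₁ x)) ≤ deg G x
      N₁<deg = begin
        suc (count (N₁ x))                                                           ≡⟨ +-comm 1 _ ⟩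
        count (N₁ x) + 1                                                             ≤⟨ +-monoʳ-≤ (count (N₁ x)) w-outside ⟩
        count (N₁ x) + count (λ y → adj G x y ∧ not (inSuffix (suc p) y))            ≡⟨ count-split (adj G x) (inSuffix (suc p)) ⟨
        deg G x                                                                      ∎
        where
          open ≤-Reasoning
          w-outside : 1 ≤ count (λ y → adj G x y ∧ not (inSuffix (suc p) y))
          w-outside = count-pos _ w (∧-intro {adj G x w} (Adj-sym w x (∧-elimˡ x∈L)) (≡false⇒not≡true w∉S₁))

      few-unique⇒nbrs⊆L : Δ G + h ≤ 2 * t → uniqueCount x < h → count (λ y → N₁ x y ∧ not (L y)) ≡ 0
      few-unique⇒nbrs⊆L dense u<h =
        n≤0⇒n≡0 (+-cancelˡ-≤ (count mate) _ 0 (subst (count mate + count (λ y → N₁ x y ∧ not (L y)) ≤_)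
                                                      (sym (+-identityʳ (count mate))) (≤-pred mates+rest<1+mates)))
        where
          mates+rest<1+mates : count mate + count (λ y → N₁ x y ∧ not (L y)) < suc (count mate)
          mates+rest<1+mates = begin-strict
            count mate + count (λ y → N₁ x y ∧ not (L y))                ≤⟨ +-monoˡ-≤ _ mates≤N₁∧L ⟩
            count (λ y → N₁ x y ∧ L y) + count (λ y → N₁ x y ∧ not (L y)) ≡⟨ count-split (N₁ x) L ⟨
            count (N₁ x)                                                   ≤⟨ few-unique⇒few-nbrs x u<h ⟩
            uniqueCount x                                                  <⟨ u<h ⟩
            h                                                              ≤⟨ dense⇒h≤t dense ⟩
            t                                                              ≡⟨ t≡1+mates ⟩
            suc (count mate)                                               ∎
            where
              open ≤-Reasoning
              mates≤N₁∧L : count mate ≤ count (λ y → N₁ x y ∧ L y)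
              mates≤N₁∧L = count-mono mate _ (λ y e → ∧-intro {N₁ x y} (mate⇒N₁ y e) (mate-L y e))

      sameColourAs : Fin n → Fin n → Bool
      sameColourAs z y = (N₁ x y ∧ ⌊ col y ≟ col z ⌋) ∧ y ≢ᵇ z

      twin : Fin n → Fin n
      twin z = choose (sameColourAs z) z

      nonUniqueMate : Fin n → Bool
      nonUniqueMate z = mate z ∧ not (U₁ x z)

      nonUniqueOutsider : Fin n → Bool
      nonUniqueOutsider y = (N₁ x y ∧ not (mate y)) ∧ not (U₁ x y)

      -- A non-unique colour on a mate z reappears on some twin y ≠ z; the twin is no mate since
      -- the clique L is properly coloured, and distinct mates have distinct colours, hence distinct twins.
      nonUniqueMates≤Outsiders : count nonUniqueMate ≤ count nonUniqueOutsider
      nonUniqueMates≤Outsiders = count-injection nonUniqueMate nonUniqueOutsider twin twin-outsider twin-injective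
        where
          occ≢1 : ∀ z → nonUniqueMate z ≡ true → ⌊ occ₁ x (col z) ℕ.≟ 1 ⌋ ≡ false
          occ≢1 z e = trans (sym (cong (_∧ ⌊ occ₁ x (col z) ℕ.≟ 1 ⌋) (mate⇒N₁ z (∧-elimˡ e))))
                            (not≡true⇒≡false (∧-elimʳ {mate z} e))
          twin-exists : ∀ z → nonUniqueMate z ≡ true → ∃ λ y → sameColourAs z y ≡ true
          twin-exists z e with search (sameColourAs z)
          ... | yes found = found
          ... | no none = ⊥-elim (≡true⇒≢false (⌊⌋-true (occ₁ x (col z) ℕ.≟ 1) occ≡1) (occ≢1 z e))
            where
              occ≡1 : occ₁ x (col z) ≡ 1
              occ≡1 = trans (count-remove (λ y → N₁ x y ∧ ⌊ col y ≟ col z ⌋) z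
                                          (∧-intro {N₁ x z} (mate⇒N₁ z (∧-elimˡ e)) (⌊⌋-true (col z ≟ col z) refl)))
                            (cong suc (count-none (sameColourAs z) (λ y → ≢true⇒≡false (λ q → none (y , q)))))
          twin-spec : ∀ z → nonUniqueMate z ≡ true → sameColourAs z (twin z) ≡ true
          twin-spec z e = let y , q = twin-exists z e in choose-spec (sameColourAs z) z y q
          twin-N₁ : ∀ z → nonUniqueMate z ≡ true → N₁ x (twin z) ≡ true
          twin-N₁ z e = ∧-elimˡ (∧-elimˡ (twin-spec z e))
          twin-col : ∀ z → nonUniqueMate z ≡ true → col (twin z) ≡ col z
          twin-col z e = ⌊⌋-sound (col (twin z) ≟ col z) (∧-elimʳ {N₁ x (twin z)} (∧-elimˡ (twin-spec z e)))
          twin-≢ : ∀ z → nonUniqueMate z ≡ true → twin z ≢ z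
          twin-≢ z e twin≡z = ≡true⇒≢false (∧-elimʳ {N₁ x (twin z) ∧ ⌊ col (twin z) ≟ col z ⌋} (twin-spec z e))
                                            (trans (cong (twin z ≢ᵇ_) (sym twin≡z)) (≢ᵇ-irrefl (twin z)))
          twin-outsider : ∀ z → nonUniqueMate z ≡ true → nonUniqueOutsider (twin z) ≡ true
          twin-outsider z e =
            ∧-intro (∧-intro {N₁ x y} (twin-N₁ z e) (≡false⇒not≡true not-mate)) (≡false⇒not≡true not-unique)
            where
              y : Fin n
              y = twin z
              z-mate : mate z ≡ true
              z-mate = ∧-elimˡ e
              not-mate : mate y ≡ false
              not-mate = ≢true⇒≡false (λ m → L-colours-distinct y z (mate-L y m) (mate-L z z-mate) (twin-≢ z e) (twin-col z e))
              not-unique : U₁ x y ≡ false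
              not-unique = trans (cong (λ c → N₁ x y ∧ ⌊ occ₁ x c ℕ.≟ 1 ⌋) (twin-col z e))
                                 (trans (cong (N₁ x y ∧_) (occ≢1 z e)) (∧-zeroʳ (N₁ x y)))
          twin-injective : ∀ z₁ z₂ → nonUniqueMate z₁ ≡ true → nonUniqueMate z₂ ≡ true →
                           twin z₁ ≡ twin z₂ → z₁ ≡ z₂
          twin-injective z₁ z₂ e₁ e₂ eq with z₁ ≟ z₂
          ... | yes z₁≡z₂ = z₁≡z₂
          ... | no  z₁≢z₂ = ⊥-elim (L-colours-distinct z₁ z₂ (mate-L z₁ (∧-elimˡ e₁)) (mate-L z₂ (∧-elimˡ e₂))
                                       z₁≢z₂ (trans (sym (twin-col z₁ e₁)) (trans (cong col eq) (twin-col z₂ e₂))))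

      -- The mates, the unique neighbours outside L and the twins of the non-unique mates are
      -- distinct neighbours of x other than w; the degree bound then leaves no room for the second kind.
      unique-outside-mates≡0 : Δ G + h ≤ 2 * t → uniqueCount x ≡ h → count (λ y → U₁ x y ∧ not (mate y)) ≡ 0
      unique-outside-mates≡0 dense u≡h =
        excess≡0 (Δ G) h (count mate) (count (λ y → U₁ x y ∧ mate y)) _ (count nonUniqueMate)
          (≤-trans (s≤s N₁-decomposition) (≤-trans N₁<deg (deg≤Δ x)))
          mates-split (trans (sym u≡h) (count-split (U₁ x) mate))
          (subst (λ m → Δ G + h ≤ 2 * m) t≡1+mates dense)
        where
          open ≤-Reasoning
          mates-split : count mate ≡ count (λ y → U₁ x y ∧ mate y) + count nonUniqueMate
          mates-split = trans (count-split mate (U₁ x))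
                              (cong (_+ count nonUniqueMate) (count-cong (λ y → ∧-comm (mate y) (U₁ x y))))
          unique-outside⇒N₁ : ∀ y → U₁ x y ∧ not (mate y) ≡ true → (N₁ x y ∧ not (mate y)) ∧ U₁ x y ≡ true
          unique-outside⇒N₁ y e = ∧-intro (∧-intro {N₁ x y} (∧-elimˡ (∧-elimˡ e)) (∧-elimʳ {U₁ x y} e)) (∧-elimˡ e)
          N₁-decomposition : count mate + (count (λ y → U₁ x y ∧ not (mate y)) + count nonUniqueMate) ≤ count (N₁ x)
          N₁-decomposition = begin
            count mate + (count (λ y → U₁ x y ∧ not (mate y)) + count nonUniqueMate)
              ≤⟨ +-mono-≤ (count-mono _ _ (λ y e → ∧-intro {N₁ x y} (mate⇒N₁ y e) e))
                          (+-mono-≤ (count-mono _ _ unique-outside⇒N₁) nonUniqueMates≤Outsiders) ⟩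
            count (λ y → N₁ x y ∧ mate y)
              + (count (λ y → (N₁ x y ∧ not (mate y)) ∧ U₁ x y) + count nonUniqueOutsider)
              ≡⟨ cong (count (λ y → N₁ x y ∧ mate y) +_) (count-split (λ y → N₁ x y ∧ not (mate y)) (U₁ x)) ⟨
            count (λ y → N₁ x y ∧ mate y) + count (λ y → N₁ x y ∧ not (mate y))
              ≡⟨ count-split (N₁ x) mate ⟨
            count (N₁ x) ∎

      kept⊆L : Δ G + h ≤ 2 * t → count (λ y → kept x y ∧ not (L y)) ≤ 0
      kept⊆L dense with <-cmp (uniqueCount x) h
      ... | tri< u<h _ _ = ≤-reflexive (trans (count-cong (λ y → cong (_∧ not (L y)) (mustKeep-< (N₁ x y) (U₁ x y) u<h)))
                                              (few-unique⇒nbrs⊆L dense u<h))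
      ... | tri≈ _ u≡h _ = ≤-trans (count-mono _ _ kept⇒unique-outside) (≤-reflexive (unique-outside-mates≡0 dense u≡h))
        where
          kept⇒unique-outside : ∀ y → kept x y ∧ not (L y) ≡ true → U₁ x y ∧ not (mate y) ≡ true
          kept⇒unique-outside y e with L y
          ... | true  = ⊥-elim (≡true⇒≢false (∧-elimʳ {kept x y} e) refl)
          ... | false = ∧-intro {U₁ x y} (trans (sym (mustKeep-≡ (N₁ x y) (U₁ x y) u≡h)) (∧-elimˡ e)) refl
      ... | tri> _ _ h<u = ≤-reflexive (count-none _ (λ y → cong (_∧ not (L y)) (mustKeep-> (N₁ x y) (U₁ x y) h<u)))

    Forbidden≤ : count Forbidden ≤ t + t * h
    Forbidden≤ = ≤-trans Forbidden≤Blocked (Blocked≤ h kept-outside-L≤h)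

    Forbidden≤-dense : Δ G + h ≤ 2 * t → count Forbidden ≤ t
    Forbidden≤-dense dense = ≤-trans Forbidden≤Blocked (≤-trans (Blocked≤ 0 (λ x x∈L → Mates.kept⊆L x x∈L dense))
                                                                 (≤-reflexive (trans (cong (t +_) (*-zeroʳ t)) (+-identityʳ t))))

    module Recolour (c : Fin k) (c-free : ∀ y → Blocked y ≡ true → col y ≢ c) where
      col′ : Fin n → Fin k
      col′ v = if ⌊ v ≟ w ⌋ then c else col v

      col′-w : col′ w ≡ c
      col′-w = cong (λ b → if b then c else col w) (⌊⌋-true (w ≟ w) refl)

      col′-≢ : ∀ v → v ≢ w → col′ v ≡ col v
      col′-≢ v v≢w = cong (λ b → if b then c else col v) (⌊⌋-false (v ≟ w) v≢w)

      L-intro : ∀ v → v ≢ w → Adj G w v → inSuffix p v ≡ true → L v ≡ true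
      L-intro v v≢w wv v∈ = ∧-intro {adj G w v} wv (S₀⊆S₁ v v≢w v∈)

      proper₀ : ProperOn p col′
      proper₀ u v uv u∈ v∈ = by-cases (u ≟ w) (v ≟ w)
        where
          by-cases : Dec (u ≡ w) → Dec (v ≡ w) → col′ u ≢ col′ v
          by-cases (yes refl) (yes refl) _  = Adj⇒≢ w w uv refl
          by-cases (yes refl) (no v≢w)   eq =
            c-free v (∨-introˡ (L-intro v v≢w uv v∈)) (trans (sym (col′-≢ v v≢w)) (trans (sym eq) col′-w))
          by-cases (no u≢w)   (yes refl) eq =
            c-free u (∨-introˡ (L-intro u u≢w (Adj-sym u w uv) u∈)) (trans (sym (col′-≢ u u≢w)) (trans eq col′-w))
          by-cases (no u≢w)   (no v≢w)   eq =
            proper₁ u v uv (S₀⊆S₁ u u≢w u∈) (S₀⊆S₁ v v≢w v∈)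
                    (trans (sym (col′-≢ u u≢w)) (trans eq (col′-≢ v v≢w)))

      N₀ : Fin n → Fin n → Bool
      N₀ = nbrIn p

      U₀ : Fin n → Fin n → Bool
      U₀ = uniqueNbrIn p col′

      occ₀ : Fin n → Fin k → ℕ
      occ₀ = occIn p col′

      N₀∖w≡N₁ : ∀ x z → N₀ x z ∧ z ≢ᵇ w ≡ N₁ x z
      N₀∖w≡N₁ x z with z ≟ w
      ... | yes refl = trans (∧-zeroʳ _) (sym (N₁-w x))
      ... | no  z≢w  = trans (∧-identityʳ _) (cong (adj G x z ∧_) (S₀≡S₁ z z≢w))

      count-N₀ : ∀ x → count (N₀ x) ≡ indicator (N₀ x w) + count (N₁ x)
      count-N₀ x = trans (count-at (N₀ x) w) (cong (indicator (N₀ x w) +_) (count-cong (N₀∖w≡N₁ x)))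

      count-occ₀ : ∀ x d → occ₀ x d ≡ indicator (N₀ x w ∧ ⌊ col′ w ≟ d ⌋) + occ₁ x d
      count-occ₀ x d = trans (count-at _ w) (cong (indicator (N₀ x w ∧ ⌊ col′ w ≟ d ⌋) +_) (count-cong restrict))
        where
          restrict : ∀ z → (N₀ x z ∧ ⌊ col′ z ≟ d ⌋) ∧ z ≢ᵇ w ≡ N₁ x z ∧ ⌊ col z ≟ d ⌋
          restrict z with z ≟ w
          ... | yes refl = trans (∧-zeroʳ _) (sym (cong (_∧ ⌊ col w ≟ d ⌋) (N₁-w x)))
          ... | no  z≢w  = trans (∧-identityʳ _) (cong (λ b → (adj G x z ∧ b) ∧ ⌊ col z ≟ d ⌋) (S₀≡S₁ z z≢w))

      cf-nonadjacent : ∀ x → adj G x w ≡ false → h ⊓ count (N₀ x) ≤ count (U₀ x)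
      cf-nonadjacent x x≁w = subst₂ (λ a b → h ⊓ a ≤ b) (sym same-nbrs) (sym same-unique) (cf₁ x)
        where
          N₀-w : N₀ x w ≡ false
          N₀-w = cong (_∧ inSuffix p w) x≁w
          same-occ : ∀ d → occ₀ x d ≡ occ₁ x d
          same-occ d = trans (count-occ₀ x d) (cong (λ b → indicator (b ∧ ⌊ col′ w ≟ d ⌋) + occ₁ x d) N₀-w)
          same-nbrs : count (N₀ x) ≡ count (N₁ x)
          same-nbrs = trans (count-N₀ x) (cong (λ b → indicator b + count (N₁ x)) N₀-w)
          same-unique-at : ∀ z → U₀ x z ≡ U₁ x z
          same-unique-at z = by-cases (z ≟ w)
            where
              by-cases : Dec (z ≡ w) → U₀ x z ≡ U₁ x z
              by-cases (yes refl) = trans (cong (_∧ ⌊ occ₀ x (col′ w) ℕ.≟ 1 ⌋) N₀-w)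
                                          (sym (cong (_∧ ⌊ occ₁ x (col w) ℕ.≟ 1 ⌋) (N₁-w x)))
              by-cases (no z≢w)   =
                cong₂ _∧_ (trans (sym (∧-identityʳ (N₀ x z))) (trans (cong (N₀ x z ∧_) (sym (≢⇒≢ᵇ z≢w))) (N₀∖w≡N₁ x z)))
                          (cong (λ m → ⌊ m ℕ.≟ 1 ⌋) (trans (cong (occ₀ x) (col′-≢ z z≢w)) (same-occ (col z))))
          same-unique : count (U₀ x) ≡ count (U₁ x)
          same-unique = count-cong same-unique-at

      module Adjacent (x : Fin n) (x~w : Adj G x w) where
        N₀-w : N₀ x w ≡ true
        N₀-w = ∧-intro {adj G x w} x~w w∈S₀

        count-N₀≡1+N₁ : count (N₀ x) ≡ suc (count (N₁ x))
        count-N₀≡1+N₁ = trans (count-N₀ x) (cong (λ b → indicator b + count (N₁ x)) N₀-w)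

        occ₀≡ : ∀ d → occ₀ x d ≡ indicator ⌊ c ≟ d ⌋ + occ₁ x d
        occ₀≡ d = trans (count-occ₀ x d)
                        (cong (λ b → indicator b + occ₁ x d) (cong₂ _∧_ N₀-w (cong (λ e → ⌊ e ≟ d ⌋) col′-w)))

        U₁⇒≢w : ∀ z → U₁ x z ≡ true → z ≢ w
        U₁⇒≢w z u refl = ≡true⇒≢false (∧-elimˡ {N₁ x w} u) (N₁-w x)

        unique-kept : ∀ z → U₁ x z ≡ true → col z ≢ c → U₀ x z ≡ true
        unique-kept z u z≢c = ∧-intro {N₀ x z} N₀-z (⌊⌋-true (occ₀ x (col′ z) ℕ.≟ 1) occ₀≡1)
          where
            N₁-z : N₁ x z ≡ true
            N₁-z = ∧-elimˡ u
            N₀-z : N₀ x z ≡ true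
            N₀-z = ∧-intro {adj G x z} (∧-elimˡ N₁-z) (S₁⊆S₀ z (∧-elimʳ {adj G x z} N₁-z))
            occ₀≡1 : occ₀ x (col′ z) ≡ 1
            occ₀≡1 = trans (cong (occ₀ x) (col′-≢ z (U₁⇒≢w z u)))
                           (trans (occ₀≡ (col z)) (cong₂ _+_ (cong indicator (⌊⌋-false (c ≟ col z) (z≢c ∘ sym)))
                                                            (⌊⌋-sound (occ₁ x (col z) ℕ.≟ 1) (∧-elimʳ {N₁ x z} u))))

        -- If c is new around x, then w joins the unique neighbours of x and all old ones stay unique.
        cf-if-c-new : (∀ y → N₁ x y ≡ true → col y ≢ c) → h ⊓ count (N₀ x) ≤ count (U₀ x)
        cf-if-c-new c-new = begin
          h ⊓ count (N₀ x)                           ≡⟨ cong (h ⊓_) count-N₀≡1+N₁ ⟩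
          h ⊓ suc (count (N₁ x))                     ≤⟨ ⊓-suc-≤ h (count (N₁ x)) ⟩
          suc (h ⊓ count (N₁ x))                     ≤⟨ s≤s (cf₁ x) ⟩
          suc (count (U₁ x))                         ≤⟨ s≤s (count-mono (U₁ x) (λ z → U₀ x z ∧ z ≢ᵇ w) kept∖w) ⟩
          suc (count (λ z → U₀ x z ∧ z ≢ᵇ w))        ≡⟨ count-remove (U₀ x) w U₀-w ⟨
          count (U₀ x)                               ∎
          where
            open ≤-Reasoning
            kept∖w : ∀ z → U₁ x z ≡ true → U₀ x z ∧ z ≢ᵇ w ≡ true
            kept∖w z u = ∧-intro {U₀ x z} (unique-kept z u (c-new z (∧-elimˡ u))) (≢⇒≢ᵇ (U₁⇒≢w z u))
            no-nbr-coloured-c : occ₁ x c ≡ 0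
            no-nbr-coloured-c =
              count-none _ (λ y → ≢true⇒≡false (λ e → c-new y (∧-elimˡ e) (⌊⌋-sound (col y ≟ c) (∧-elimʳ {N₁ x y} e))))
            occ₀-c≡1 : occ₀ x (col′ w) ≡ 1
            occ₀-c≡1 = trans (cong (occ₀ x) col′-w)
                             (trans (occ₀≡ c) (cong₂ _+_ (cong indicator (⌊⌋-true (c ≟ c) refl)) no-nbr-coloured-c))
            U₀-w : U₀ x w ≡ true
            U₀-w = ∧-intro {N₀ x w} N₀-w (⌊⌋-true (occ₀ x (col′ w) ℕ.≟ 1) occ₀-c≡1)

        earlier⇒nbrs⊆L : inSuffix (suc p) x ≡ false → ∀ y → N₁ x y ≡ true → L y ≡ true
        earlier⇒nbrs⊆L x∉S₁ y xy = ∧-intro {adj G w y} (later-nbrs-adjacent x w y x<w x<y w≢y x~w (∧-elimˡ xy)) y∈S₁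
          where
            x<w : rank x < rank w
            x<w = subst (rank x <_) (sym rank-w)
                    (≤∧≢⇒< (≤-pred (inSuffix-false x∉S₁)) (λ e → Adj⇒≢ x w x~w (rank-injective x w (trans e (sym rank-w)))))
            y∈S₁ : inSuffix (suc p) y ≡ true
            y∈S₁ = ∧-elimʳ {adj G x y} xy
            x<y : rank x < rank y
            x<y = <-trans x<w (subst (_< rank y) (sym rank-w) (inSuffix-elim y∈S₁))
            w≢y : w ≢ y
            w≢y refl = ≡true⇒≢false y∈S₁ w∉S₁

        kept⇒c-free : L x ≡ true → ∀ y → kept x y ≡ true → col y ≢ c
        kept⇒c-free x∈L y e = c-free y (∨-introʳ {L y} (any-intro (λ x′ → L x′ ∧ kept x′ y) x (∧-intro {L x} x∈L e)))

        cf-in-L : L x ≡ true → h ⊓ count (N₀ x) ≤ count (U₀ x)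
        cf-in-L x∈L with <-cmp (uniqueCount x) h
        ... | tri< u<h _ _ = cf-if-c-new (λ y e → kept⇒c-free x∈L y (trans (mustKeep-< (N₁ x y) (U₁ x y) u<h) e))
        ... | tri≈ _ u≡h _ = begin
          h ⊓ count (N₀ x)  ≤⟨ m⊓n≤m h _ ⟩
          h                 ≡⟨ u≡h ⟨
          uniqueCount x     ≤⟨ count-mono (U₁ x) (U₀ x) all-kept ⟩
          count (U₀ x)      ∎
          where
            open ≤-Reasoning
            all-kept : ∀ y → U₁ x y ≡ true → U₀ x y ≡ true
            all-kept y u = unique-kept y u (kept⇒c-free x∈L y (trans (mustKeep-≡ (N₁ x y) (U₁ x y) u≡h) u))
        -- Only the unique neighbour coloured c, if any, stops being unique, and x has one to spare.
        ... | tri> _ _ h<u = ≤-trans (m⊓n≤m h _) (≤-pred (begin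
          suc h                                                                             ≤⟨ h<u ⟩
          uniqueCount x                                                                     ≡⟨ count-split (U₁ x) coloured-c ⟩
          count (λ y → U₁ x y ∧ coloured-c y) + count (λ y → U₁ x y ∧ not (coloured-c y))  ≤⟨ +-mono-≤ at-most-one others-kept ⟩
          1 + count (U₀ x)                                                                  ∎))
          where
            open ≤-Reasoning
            coloured-c : Fin n → Bool
            coloured-c y = ⌊ col y ≟ c ⌋
            at-most-one : count (λ y → U₁ x y ∧ coloured-c y) ≤ 1
            at-most-one with search (λ y → U₁ x y ∧ coloured-c y)
            ... | no none = ≤-trans (≤-reflexive (count-none _ (λ y → ≢true⇒≡false (λ e → none (y , e))))) z≤n
            ... | yes (y₀ , e₀) = begin
              count (λ y → U₁ x y ∧ coloured-c y)  ≤⟨ count-mono _ (λ y → N₁ x y ∧ coloured-c y)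
                                                       (λ y e → ∧-intro {N₁ x y} (∧-elimˡ (∧-elimˡ {U₁ x y} e))
                                                                                  (∧-elimʳ {U₁ x y} e)) ⟩
              occ₁ x c                              ≡⟨ cong (occ₁ x) (⌊⌋-sound (col y₀ ≟ c) (∧-elimʳ {U₁ x y₀} e₀)) ⟨
              occ₁ x (col y₀)                       ≡⟨ ⌊⌋-sound (occ₁ x (col y₀) ℕ.≟ 1)
                                                                   (∧-elimʳ {N₁ x y₀} (∧-elimˡ {U₁ x y₀} e₀)) ⟩
              1                                     ∎
            others-kept : count (λ y → U₁ x y ∧ not (coloured-c y)) ≤ count (U₀ x)
            others-kept = count-mono _ _ (λ y e → unique-kept y (∧-elimˡ {U₁ x y} e)
                                                    (λ eq → ≡true⇒≢false (⌊⌋-true (col y ≟ c) eq)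
                                                                           (not≡true⇒≡false (∧-elimʳ {U₁ x y} e))))

      cf₀ : ConflictFreeOn p col′
      cf₀ x with adj G x w in x~w | inSuffix (suc p) x in x∈S₁
      ... | false | _     = cf-nonadjacent x x~w
      ... | true  | false = Adjacent.cf-if-c-new x x~w (λ y e → c-free y (∨-introˡ (Adjacent.earlier⇒nbrs⊆L x x~w x∈S₁ y e)))
      ... | true  | true  = Adjacent.cf-in-L x x~w (∧-intro {adj G w x} (Adj-sym x w x~w) x∈S₁)

    extend : count Forbidden < k → Σ (Fin n → Fin k) (Good p)
    extend few with search (λ c → not (Forbidden c))
    ... | yes (c , free) = col′ , proper₀ , cf₀
      where open Recolour c (λ y b eq → ≡true⇒≢false (any-intro _ y (∧-intro {Blocked y} b (⌊⌋-true (col y ≟ c) eq)))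
                                                      (not≡true⇒≡false free))
    ... | no none = ⊥-elim (<-irrefl (count-all Forbidden all-forbidden) few)
      where
        all-forbidden : ∀ c → Forbidden c ≡ true
        all-forbidden c = ¬-not {y = false} (λ e → none (c , cong not e))

  empty-suffix-good : ∀ col → Good n col
  empty-suffix-good col = (λ u v _ u∈S _ → ⊥-elim (nothing-in-suffix u u∈S)) ,
                          (λ x → ≤-trans (m⊓n≤n h _) (≤-trans (≤-reflexive (count-none (nbrIn n x) (no-nbr x))) z≤n))
    where
      nothing-in-suffix : ∀ v → inSuffix n v ≢ true
      nothing-in-suffix v e = <⇒≱ (toℕ<n (position v)) (inSuffix-elim e)
      no-nbr : ∀ x y → nbrIn n x y ≡ false
      no-nbr x y = trans (cong (adj G x y ∧_) (≢true⇒≡false (nothing-in-suffix y))) (∧-zeroʳ (adj G x y))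

  Budget : ℕ → Set
  Budget s = ∀ t → suc t ≤ s → t ≤ Δ G → t < k × (¬ (Δ G + h ≤ 2 * t) → t + t * h < k)

  good-colouring : ∀ {s} → (∀ i K → IsSimplicialClique G σ i K → ∣ K ∣ ≤ s) → Budget s → Fin k →
                   ∀ d p → p + d ≡ n → Σ (Fin n → Fin k) (Good p)
  good-colouring _ _ c₀ zero p p+0≡n =
    (λ _ → c₀) , subst (λ q → Good q (λ _ → c₀)) (trans (sym p+0≡n) (+-identityʳ p)) (empty-suffix-good (λ _ → c₀))
  good-colouring {s} cliques≤s budget c₀ (suc d) p p+1+d≡n = extend Forbidden<k
    where
      p<n : p < n
      p<n = subst (p <_) p+1+d≡n (m<m+n p ℕ.z<s)
      later : Σ (Fin n → Fin k) (Good (suc p))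
      later = good-colouring cliques≤s budget c₀ d (suc p) (trans (sym (+-suc p d)) p+1+d≡n)
      open Extension p p<n (proj₁ later) (proj₂ later)
      Forbidden<k : count Forbidden < k
      Forbidden<k with Δ G + h ≤? 2 * t | budget t (laterNbrs-bound cliques≤s p p<n) t≤Δ
      ... | yes dense  | t<k , _     = ≤-<-trans (Forbidden≤-dense dense) t<k
      ... | no  sparse | _   , bound = ≤-<-trans Forbidden≤ (bound sparse)

  good⇒properCF : ∀ col → Good 0 col → IsProperCFColoring h G col
  good⇒properCF col (proper , cf) = (λ u v uv → proper u v uv refl refl) , cf′
    where
      nbrIn0≡adj : ∀ v y → nbrIn 0 v y ≡ adj G v y
      nbrIn0≡adj v y = ∧-identityʳ (adj G v y)
      occ≡occIn0 : ∀ v d → occ G col v d ≡ occIn 0 col v d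
      occ≡occIn0 v d = count-cong (λ y → cong (_∧ ⌊ col y ≟ d ⌋) (sym (nbrIn0≡adj v y)))
      unique-colour : ∀ v y → uniqueNbrIn 0 col v y ≡ true → occIn 0 col v (col y) ≡ 1
      unique-colour v y u = ⌊⌋-sound (occIn 0 col v (col y) ℕ.≟ 1) (∧-elimʳ {nbrIn 0 v y} u)
      cf′ : ∀ v → deg G v ⊓ h ≤ uniqueColours G col v
      cf′ v = begin
        deg G v ⊓ h                   ≡⟨ ⊓-comm (deg G v) h ⟩
        h ⊓ deg G v                   ≡⟨ cong (h ⊓_) (count-cong (nbrIn0≡adj v)) ⟨
        h ⊓ count (nbrIn 0 v)         ≤⟨ cf v ⟩
        count (uniqueNbrIn 0 col v)   ≤⟨ count-injection (uniqueNbrIn 0 col v) (λ d → ⌊ occ G col v d ℕ.≟ 1 ⌋) col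
                                            (λ y u → ⌊⌋-true (occ G col v (col y) ℕ.≟ 1)
                                                             (trans (occ≡occIn0 v (col y)) (unique-colour v y u)))
                                            colour-injective ⟩
        uniqueColours G col v         ∎
        where
          open ≤-Reasoning
          colour-injective : ∀ y₁ y₂ → uniqueNbrIn 0 col v y₁ ≡ true → uniqueNbrIn 0 col v y₂ ≡ true →
                             col y₁ ≡ col y₂ → y₁ ≡ y₂
          colour-injective y₁ y₂ u₁ u₂ eq =
            count≡1⇒unique (λ z → nbrIn 0 v z ∧ ⌊ col z ≟ col y₁ ⌋) (unique-colour v y₁ u₁) y₁ y₂
              (∧-intro {nbrIn 0 v y₁} (∧-elimˡ u₁) (⌊⌋-true (col y₁ ≟ col y₁) refl))
              (∧-intro {nbrIn 0 v y₂} (∧-elimˡ u₂) (⌊⌋-true (col y₂ ≟ col y₁) (sym eq)))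

half-bound : ∀ {t Y} → 2 * t ≤ Y → t < suc ℕ.⌊ Y /2⌋
half-bound {t} {Y} 2t≤Y =
  s≤s (≤-trans (≤-reflexive (n≡⌊n+n/2⌋ t)) (⌊n/2⌋-mono (subst (_≤ Y) (cong (t +_) (+-identityʳ t)) 2t≤Y)))

twice-half : ∀ Y → 2 * suc ℕ.⌊ Y /2⌋ ≤ 2 + Y
twice-half Y = begin
  2 * suc X           ≡⟨ *-distribˡ-+ 2 1 X ⟩
  2 + 2 * X           ≡⟨ cong (λ m → 2 + (X + m)) (+-identityʳ X) ⟩
  2 + (X + X)         ≤⟨ +-monoʳ-≤ 2 (+-monoʳ-≤ X (⌊n/2⌋≤⌈n/2⌉ Y)) ⟩
  2 + (X + ℕ.⌈ Y /2⌉) ≡⟨ cong (2 +_) (⌊n/2⌋+⌈n/2⌉≡n Y) ⟩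
  2 + Y               ∎
  where
    open ≤-Reasoning
    X : ℕ
    X = ℕ.⌊ Y /2⌋

colour-budget : ∀ h s Δ t → 1 ≤ h → suc t ≤ s → t ≤ Δ →
  let Y = (h + 1) * ((2 * (s ∸ 1)) ⊓ (Δ + h ∸ 1)) in
  2 * t ≤ Y × (¬ (Δ + h ≤ 2 * t) → 2 * (t + t * h) ≤ Y)
colour-budget h@(suc h′) s Δ t h≥1 t<s t≤Δ = always , if-sparse
  where
    open ≤-Reasoning
    M : ℕ
    M = (2 * (s ∸ 1)) ⊓ (Δ + h ∸ 1)
    t≤s-1 : t ≤ s ∸ 1
    t≤s-1 = ∸-monoˡ-≤ 1 t<s
    Δ≤Δ+h-1 : Δ ≤ Δ + h ∸ 1
    Δ≤Δ+h-1 = ≤-trans (m≤m+n Δ h′) (≤-reflexive (cong (_∸ 1) (sym (+-suc Δ h′))))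
    always : 2 * t ≤ (h + 1) * M
    always = begin
      2 * t       ≤⟨ *-monoʳ-≤ 2 (⊓-glb (≤-trans t≤s-1 (m≤m+n (s ∸ 1) _)) (≤-trans t≤Δ Δ≤Δ+h-1)) ⟩
      2 * M       ≤⟨ *-monoˡ-≤ M (+-monoˡ-≤ 1 h≥1) ⟩
      (h + 1) * M ∎
    if-sparse : ¬ (Δ + h ≤ 2 * t) → 2 * (t + t * h) ≤ (h + 1) * M
    if-sparse sparse = begin
      2 * (t + t * h)   ≡⟨ regroup t h ⟩
      (h + 1) * (2 * t) ≤⟨ *-monoʳ-≤ (h + 1) (⊓-glb (*-monoʳ-≤ 2 t≤s-1) (∸-monoˡ-≤ 1 (≰⇒> sparse))) ⟩
      (h + 1) * M       ∎
      where
        regroup : ∀ t h → 2 * (t + t * h) ≡ (h + 1) * (2 * t)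
        regroup = solve-∀

theorem1p5 : (h : ℕ) → 1 ≤ h → (n : ℕ) (G : Graph n) → Chordal G →
    (s : ℕ) → IsMaxSimplicialCliqueSize G s →
    ∃[ k ] Σ (Fin n → Fin k) (λ col → IsProperCFColoring h G col ×
      2 * k ≤ 2 + (h + 1) * ((2 * (s ∸ 1)) ⊓ (Δ G + h ∸ 1)))
theorem1p5 h h≥1 n G _ s ((σ , _ , _ , simplicial , _ , _) , cliques≤s) =
  k , proj₁ colouring , good⇒properCF (proj₁ colouring) (proj₂ colouring) , twice-half Y
  where
    Y : ℕ
    Y = (h + 1) * ((2 * (s ∸ 1)) ⊓ (Δ G + h ∸ 1))
    k : ℕ
    k = suc ℕ.⌊ Y /2⌋
    open ReverseGreedy G σ simplicial h k
    budget : Budget s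
    budget t t<s t≤Δ with colour-budget h s (Δ G) t h≥1 t<s t≤Δ
    ... | always , if-sparse = half-bound always , λ sparse → half-bound (if-sparse sparse)
    colouring : Σ (Fin n → Fin k) (Good 0)
    colouring = good-colouring (λ i K → cliques≤s σ i K simplicial) budget zero n 0 refl
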